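{- Let $d\ge 2$. For $i\in\{0,\ldots,2^{d-1}-1\}$ write $i=\sum_{k=0}^{d-2} b_{i,k}2^k$ in binary ($b_{i,k}\in\{0,1\}$), and for $t\in\mathbb{N}_0$ define $R_{i,1}(t)=(2^d-1)t+2i+1$ and, for $j\in\{2,\ldots,d\}$, $R_{i,j}(t)=2R_{i,j-1}(t)-b_{i,d-j}$. Then for every $n\in\mathbb{N}$, $$\mathbf{r}(n)=\big(R_{i,1}(t),\ldots,R_{i,d}(t)\big),\quad\text{where } i=(n-1)\bmod 2^{d-1},\ t=\left\lfloor\frac{n-1}{2^{d-1}}\right\rfloor.$$
   Context: $\mathbb{N}=\{1,2,\ldots\}$, $\mathbb{N}_0=\mathbb{N}\cup\{0\}$. For $n\in\mathbb{N}$ and $i\in\{1,\ldots,d\}$, $r_i(n)=\left\lfloor \frac{(2^d-1)n}{2^{d-i}}\right\rfloor-2^{i-1}+1$ and $\mathbf{r}(n)=(r_1(n),\ldots,r_d(n))$. -}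

module Defs where

open import Data.Nat as ℕ using (ℕ; zero; suc; _^_; _∸_; NonZero)
open import Data.Nat.DivMod using (_/_; _%_)
open import Data.Nat.Properties using (m^n≢0)
open import Data.Integer as ℤ using (ℤ; +_)
open import Data.Fin using (Fin; toℕ)

_/2^_ : ℕ → ℕ → ℕ
m /2^ k = _/_ m (2 ^ k) {{m^n≢0 2 k}}

_%2^_ : ℕ → ℕ → ℕ
m %2^ k = _%_ m (2 ^ k) {{m^n≢0 2 k}}

r : (d i n : ℕ) → ℤ
r d i n = (+ ((((2 ^ d) ∸ 1) ℕ.* n) /2^ (d ∸ i)) ℤ.- + (2 ^ (i ∸ 1))) ℤ.+ + 1

rvec : (d n : ℕ) → Fin d → ℤ
rvec d n k = r d (suc (toℕ k)) n

bit : (i k : ℕ) → ℕ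
bit i k = (i /2^ k) % 2

-- R_{i,j}(t) for j ≥ 1 (R d i 0 t is an unused junk value; j = 1 is the base case)
R : (d i j t : ℕ) → ℤ
R d i zero t = + 0
R d i (suc zero) t = + (((2 ^ d) ∸ 1) ℕ.* t ℕ.+ 2 ℕ.* i ℕ.+ 1)
R d i (suc (suc j)) t = + 2 ℤ.* R d i (suc j) t ℤ.- + bit i (d ∸ suc (suc j))

Rvec : (d i t : ℕ) → Fin d → ℤ
Rvec d i t k = R d i (suc (toℕ k)) t

-- Fix the component j = k + 1 and put a = 2^k, P = 2^(d-1-k), so that aP = 2^(d-1),
-- and write n - 1 = i + t·2^(d-1).  Both sides equal a·R_{i,1}(t) - ⌊i/P⌋.
-- For R this is the closed form of the recursion: doubling and subtracting the digits
-- b_{i,d-2}, …, b_{i,d-j} one at a time reassembles the top digits ⌊i/P⌋ of i.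
-- For r it holds because (2^d - 1)n = (2aP - 1)(1 + i + taP) differs from
-- (a·R_{i,1}(t) + a - ⌊i/P⌋ - 1)·P by the remainder P - 1 - (i mod P) ∈ [0, P).
module Submission where

open import Defs
open import Data.Nat using (ℕ; zero; suc; _+_; _*_; _∸_; _^_; _≤_; _<_; NonZero; z<s)
open import Data.Nat.Properties
open import Data.Nat.DivMod
open import Data.Nat.Divisibility using (divides-refl)
open import Data.Nat.Tactic.RingSolver as ℕ-Solver using ()
open import Data.Integer as ℤ using (ℤ; +_)
import Data.Integer.Properties as ℤ
open import Data.Integer.Tactic.RingSolver as ℤ-Solver using ()
open import Data.List using (_∷_; [])
open import Data.Fin using (Fin; toℕ)
open import Data.Fin.Properties using (toℕ<n)
open import Relation.Binary.PropositionalEquality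
  using (_≡_; sym; trans; cong; cong₂; module ≡-Reasoning)

open ≡-Reasoning

[m+kn]/n≡m/n+k : ∀ m k n .{{_ : NonZero n}} → (m + k * n) / n ≡ m / n + k
[m+kn]/n≡m/n+k m k n = trans (+-distrib-/-∣ʳ m (divides-refl k)) (cong (λ q → m / n + q) (m*n/n≡m k n))

suc[m/n]*n≡n∸suc[m%n]+suc[m] : ∀ m n .{{_ : NonZero n}} → suc (m / n) * n ≡ n ∸ suc (m % n) + suc m
suc[m/n]*n≡n∸suc[m%n]+suc[m] m n = begin
  n + m / n * n            ≡⟨ cong (λ x → x + m / n * n) (m+[n∸m]≡n (m%n<n m n)) ⟨
  suc ρ + ρ' + m / n * n   ≡⟨ shuffle ρ ρ' (m / n * n) ⟩
  ρ' + suc (ρ + m / n * n) ≡⟨ cong (λ x → ρ' + suc x) (m≡m%n+[m/n]*n m n) ⟨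
  ρ' + suc m               ∎
  where
  ρ ρ' : ℕ
  ρ = m % n
  ρ' = n ∸ suc ρ
  shuffle : ∀ x y z → suc x + y + z ≡ y + suc (x + z)
  shuffle = ℕ-Solver.solve-∀

m/2^e≡bit+m/2^[1+e]*2 : ∀ m e → m /2^ e ≡ bit m e + m /2^ suc e * 2
m/2^e≡bit+m/2^[1+e]*2 m e = begin
  m /2^ e                       ≡⟨ m≡m%n+[m/n]*n (m /2^ e) 2 ⟩
  bit m e + m /2^ e / 2 * 2     ≡⟨ cong (λ q → bit m e + q * 2) (m/n/o≡m/[n*o] m (2 ^ e) 2) ⟩
  bit m e + m / (2 ^ e * 2) * 2 ≡⟨ cong (λ q → bit m e + q * 2) (/-congʳ (*-comm (2 ^ e) 2)) ⟩
  bit m e + m /2^ suc e * 2     ∎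
  where
  instance
    _ = m^n≢0 2 e
    _ = m^n≢0 2 (suc e)
    _ = m*n≢0 (2 ^ e) 2

2*[x-q]-b≡2x-[b+q*2] : ∀ x q b → + 2 ℤ.* (+ x ℤ.- + q) ℤ.- + b ≡ + (2 * x) ℤ.- + (b + q * 2)
2*[x-q]-b≡2x-[b+q*2] x q b = begin
  + 2 ℤ.* (+ x ℤ.- + q) ℤ.- + b               ≡⟨ ring (+ x) (+ q) (+ b) ⟩
  + 2 ℤ.* + x ℤ.- (+ b ℤ.+ + q ℤ.* + 2)       ≡⟨ cong₂ (λ y r → y ℤ.- (+ b ℤ.+ r)) (ℤ.pos-* 2 x) (ℤ.pos-* q 2) ⟨
  + (2 * x) ℤ.- (+ b ℤ.+ + (q * 2))           ≡⟨ cong (λ r → + (2 * x) ℤ.- r) (ℤ.pos-+ b (q * 2)) ⟨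
  + (2 * x) ℤ.- + (b + q * 2)                 ∎
  where
  ring : ∀ x q b → + 2 ℤ.* (x ℤ.- q) ℤ.- b ≡ + 2 ℤ.* x ℤ.- (b ℤ.+ q ℤ.* + 2)
  ring = ℤ-Solver.solve-∀

[m-n]+1≡o-p : ∀ {m n o p} → m + suc p ≡ o + n → + m ℤ.- + n ℤ.+ + 1 ≡ + o ℤ.- + p
[m-n]+1≡o-p {m} {n} {o} {p} m+1+p≡o+n = begin
  + m ℤ.- + n ℤ.+ + 1                    ≡⟨ ring₁ (+ m) (+ n) (+ p) ⟩
  + m ℤ.+ (+ 1 ℤ.+ + p) ℤ.- + n ℤ.- + p  ≡⟨ cong (λ x → x ℤ.- + n ℤ.- + p) (ℤ.pos-+ m (suc p)) ⟨
  + (m + suc p) ℤ.- + n ℤ.- + p          ≡⟨ cong (λ x → + x ℤ.- + n ℤ.- + p) m+1+p≡o+n ⟩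
  + (o + n) ℤ.- + n ℤ.- + p              ≡⟨ cong (λ x → x ℤ.- + n ℤ.- + p) (ℤ.pos-+ o n) ⟩
  + o ℤ.+ + n ℤ.- + n ℤ.- + p            ≡⟨ ring₂ (+ o) (+ n) (+ p) ⟩
  + o ℤ.- + p                            ∎
  where
  ring₁ : ∀ m n p → m ℤ.- n ℤ.+ + 1 ≡ m ℤ.+ (+ 1 ℤ.+ p) ℤ.- n ℤ.- p
  ring₁ = ℤ-Solver.solve-∀
  ring₂ : ∀ o n p → o ℤ.+ n ℤ.- n ℤ.- p ≡ o ℤ.- p
  ring₂ = ℤ-Solver.solve-∀

R₁ : (d i t : ℕ) → ℕ
R₁ d i t = (2 ^ d ∸ 1) * t + 2 * i + 1

R-closedForm : ∀ {d i} k t → k < d → i < 2 ^ (d ∸ 1) →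
  R d i (suc k) t ≡ + (2 ^ k * R₁ d i t) ℤ.- + (i /2^ (d ∸ suc k))
R-closedForm {d} {i} zero t _ i<2^[d-1] = sym (begin
  + (1 * R₁ d i t) ℤ.- + (i /2^ (d ∸ 1))
    ≡⟨ cong₂ (λ x q → + x ℤ.- + q) (*-identityˡ _) (m<n⇒m/n≡0 {{m^n≢0 2 (d ∸ 1)}} i<2^[d-1]) ⟩
  + R₁ d i t ℤ.- + 0
    ≡⟨ ℤ.+-identityʳ _ ⟩
  + R₁ d i t ∎)
R-closedForm {d} {i} (suc k) t 1+k<d i<2^[d-1] = begin
  + 2 ℤ.* R d i (suc k) t ℤ.- + bit i e
    ≡⟨ cong (λ x → + 2 ℤ.* x ℤ.- + bit i e) (R-closedForm k t (<⇒≤ 1+k<d) i<2^[d-1]) ⟩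
  + 2 ℤ.* (+ (2 ^ k * R₁ d i t) ℤ.- + (i /2^ (d ∸ suc k))) ℤ.- + bit i e
    ≡⟨ cong (λ f → + 2 ℤ.* (+ (2 ^ k * R₁ d i t) ℤ.- + (i /2^ f)) ℤ.- + bit i e) (+-∸-assoc 1 1+k<d) ⟩
  + 2 ℤ.* (+ (2 ^ k * R₁ d i t) ℤ.- + (i /2^ suc e)) ℤ.- + bit i e
    ≡⟨ 2*[x-q]-b≡2x-[b+q*2] (2 ^ k * R₁ d i t) (i /2^ suc e) (bit i e) ⟩
  + (2 * (2 ^ k * R₁ d i t)) ℤ.- + (bit i e + i /2^ suc e * 2)
    ≡⟨ cong₂ (λ x q → + x ℤ.- + q) (*-assoc 2 (2 ^ k) _) (m/2^e≡bit+m/2^[1+e]*2 i e) ⟨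
  + (2 ^ suc k * R₁ d i t) ℤ.- + (i /2^ e) ∎
  where
  e : ℕ
  e = d ∸ suc (suc k)

scaled-numerator-decomposition : ∀ a c t i P Q s' → suc Q * P ≡ s' + suc i → suc c ≡ 2 * (a * P) →
  c * suc (i + t * (a * P)) + suc Q * P ≡ s' + (a * (c * t + 2 * i + 1) + a) * P
-- Both sides are compared after adding 1 + i, which lets c + 1 = 2aP replace the truncated c = 2aP ∸ 1.
scaled-numerator-decomposition a c t i P Q s' [1+Q]P≡s'+1+i 1+c≡2aP = +-cancelʳ-≡ (suc i) _ _ (begin
  c * suc (i + t * (a * P)) + suc Q * P + suc i
    ≡⟨ ℕ-Solver.solve (a ∷ c ∷ t ∷ i ∷ P ∷ Q ∷ []) ⟩
  c * (t * (a * P)) + suc c * suc i + suc Q * P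
    ≡⟨ cong₂ (λ x y → c * (t * (a * P)) + x * suc i + y) 1+c≡2aP [1+Q]P≡s'+1+i ⟩
  c * (t * (a * P)) + 2 * (a * P) * suc i + (s' + suc i)
    ≡⟨ ℕ-Solver.solve (a ∷ c ∷ t ∷ i ∷ P ∷ s' ∷ []) ⟩
  s' + (a * (c * t + 2 * i + 1) + a) * P + suc i ∎)

scaled-numerator-quotient : ∀ a c t i P .{{_ : NonZero P}} → suc c ≡ 2 * (a * P) →
  c * suc (i + t * (a * P)) / P + suc (i / P) ≡ a * (c * t + 2 * i + 1) + a
scaled-numerator-quotient a c t i P 1+c≡2aP = begin
  c * n / P + suc Q        ≡⟨ [m+kn]/n≡m/n+k (c * n) (suc Q) P ⟨
  (c * n + suc Q * P) / P  ≡⟨ /-congˡ (scaled-numerator-decomposition a c t i P Q s' [1+Q]P≡s'+1+i 1+c≡2aP) ⟩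
  (s' + Y * P) / P         ≡⟨ [m+kn]/n≡m/n+k s' Y P ⟩
  s' / P + Y               ≡⟨ cong (λ x → x + Y) (m<n⇒m/n≡0 s'<P) ⟩
  Y                        ∎
  where
  n Y Q s' : ℕ
  n = suc (i + t * (a * P))
  Y = a * (c * t + 2 * i + 1) + a
  Q = i / P
  s' = P ∸ suc (i % P)
  s'<P : s' < P
  s'<P = ∸-monoʳ-< z<s (m%n<n i P)
  [1+Q]P≡s'+1+i : suc Q * P ≡ s' + suc i
  [1+Q]P≡s'+1+i = suc[m/n]*n≡n∸suc[m%n]+suc[m] i P

r-closedForm : ∀ {d k} m → k < d →
  r d (suc k) (suc m) ≡ + (2 ^ k * R₁ d (m %2^ (d ∸ 1)) (m /2^ (d ∸ 1))) ℤ.- + ((m %2^ (d ∸ 1)) /2^ (d ∸ suc k))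
r-closedForm {d} {k} m k<d = [m-n]+1≡o-p (begin
  (c * suc m) /2^ e + suc (i /2^ e)                 ≡⟨ cong (λ x → (c * suc x) /2^ e + suc (i /2^ e)) m≡i+t*aP ⟩
  (c * suc (i + t * (a * P))) /2^ e + suc (i /2^ e) ≡⟨ scaled-numerator-quotient a c t i P {{m^n≢0 2 e}} 1+c≡2aP ⟩
  a * R₁ d i t + a                                  ∎)
  where
  e a P c i t : ℕ
  e = d ∸ suc k
  a = 2 ^ k
  P = 2 ^ e
  c = 2 ^ d ∸ 1
  i = m %2^ (d ∸ 1)
  t = m /2^ (d ∸ 1)
  d≡1+k+e : d ≡ suc (k + e)
  d≡1+k+e = sym (m+[n∸m]≡n k<d)
  2^[d-1]≡aP : 2 ^ (d ∸ 1) ≡ a * P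
  2^[d-1]≡aP = trans (cong (λ x → 2 ^ (x ∸ 1)) d≡1+k+e) (^-distribˡ-+-* 2 k e)
  1+c≡2aP : suc c ≡ 2 * (a * P)
  1+c≡2aP = trans (m+[n∸m]≡n (m^n>0 2 d)) (trans (cong (2 ^_) d≡1+k+e) (cong (2 *_) (^-distribˡ-+-* 2 k e)))
  m≡i+t*aP : m ≡ i + t * (a * P)
  m≡i+t*aP = trans (m≡m%n+[m/n]*n m (2 ^ (d ∸ 1)) {{m^n≢0 2 (d ∸ 1)}}) (cong (λ x → i + t * x) 2^[d-1]≡aP)

theorem4 : (d : ℕ) → 2 ≤ d → (n : ℕ) → 1 ≤ n →
    (k : Fin d) →
    rvec d n k ≡ Rvec d ((n ∸ 1) %2^ (d ∸ 1)) ((n ∸ 1) /2^ (d ∸ 1)) k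
theorem4 d _ zero () k
theorem4 d _ (suc m) _ k = begin
  r d (suc (toℕ k)) (suc m)
    ≡⟨ r-closedForm m (toℕ<n k) ⟩
  + (2 ^ toℕ k * R₁ d i t) ℤ.- + (i /2^ (d ∸ suc (toℕ k)))
    ≡⟨ R-closedForm (toℕ k) t (toℕ<n k) i<2^[d-1] ⟨
  R d i (suc (toℕ k)) t
    ∎
  where
  i t : ℕ
  i = m %2^ (d ∸ 1)
  t = m /2^ (d ∸ 1)
  i<2^[d-1] : i < 2 ^ (d ∸ 1)
  i<2^[d-1] = m%n<n m (2 ^ (d ∸ 1)) {{m^n≢0 2 (d ∸ 1)}}
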